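{- Let $G$ be a graph and $R\subseteq V(G)$ with $|R|\ge 2$. If $G$ has a Pendant $R$-CIST or a Non-pendant $R$-CIST of size $k\le |R|$, then there exists a directed $R$-minor of $G$ that has a CISA of size $k$.
   Context: Graphs are finite and connected, may have parallel edges but no loops. For a (directed or undirected) tree $T$, $\mathrm{int}(T)$ is the set of vertices of degree at least 2 in the underlying undirected tree and $L(T)$ the set of the other vertices (leaves). An $R$-Steiner tree is a subtree $T$ of $G$ with $R\subseteq V(T)$ and $L(T)\subseteq R$; it is pendant if $L(T)=R$ and non-pendant if $\mathrm{int}(T)\cap R\neq\emptyset$. An $R$-CIST of size $k$ is a set $\{T_1,\dots,T_k\}$ of $R$-Steiner trees such that for all distinct $u,v\in R$ and distinct $i,j$, the $(u,v)$-paths in $T_i$ and $T_j$ are edge-disjoint and internally vertex-disjoint; it is Pendant (resp. Non-pendant) if all its trees are pendant (resp. non-pendant). Directed $R$-minor: let $\mathcal P=\{V_1,\dots,V_{|R|}\}$ be a partition of $V(G)$ with $|V_i\cap R|=1$ and $G[V_i]$ connected for all $i$; the directed $R$-minor induced by $\mathcal P$ is the digraph with vertex set $\mathcal P$ in which there is an arc $(V_i,V_j)$ ($i\ne j$) for each edge of $G$ joining a vertex of $V_i$ to the terminal in $V_j$ (so two adjacent terminals give a directed 2-cycle). An arborescence in a digraph is a tree in which every vertex except one (the root, of in-degree 0) has in-degree 1 in the tree. A CISA of size $k$ in a digraph $D$ is a set $\{T_1,\dots,T_k\}$ of spanning arborescences of $D$ with $\mathrm{int}(T_i)\cap\mathrm{int}(T_j)=\emptyset$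 and $A(T_i)\cap A(T_j)=\emptyset$ for all distinct $i,j$. -}

module Defs where

open import Data.Nat using (ℕ; _≤_)
open import Data.Fin using (Fin)
open import Data.Bool using (Bool; true; false; if_then_else_)
open import Data.Product using (Σ; Σ-syntax; _×_; _,_; proj₁; proj₂)
open import Data.Sum using (_⊎_)
open import Data.Unit using (⊤)
open import Data.Empty using (⊥)
open import Data.List using (List; []; _∷_)
open import Data.List.Membership.Propositional using (_∈_)
open import Data.List.Relation.Unary.Unique.Propositional using (Unique)
open import Relation.Binary.PropositionalEquality using (_≡_; _≢_)
open import Relation.Nullary using (¬_)

-- Also used for digraphs:
-- for a digraph, end₁ is the tail and end₂ the head of an arc, and the
-- undirected notions below (walks, trees, int) refer to the underlying
-- undirected multigraph.

record Multigraph : Set₁ where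
  field
    V    : Set
    E    : Set
    end₁ : E → V
    end₂ : E → V

mkGraph : (n m : ℕ) → (Fin m → Fin n) → (Fin m → Fin n) → Multigraph
mkGraph n m e₁ e₂ = record { V = Fin n ; E = Fin m ; end₁ = e₁ ; end₂ = e₂ }

module _ (G : Multigraph) where
  open Multigraph G

  Joins : E → V → V → Set
  Joins e u w = (end₁ e ≡ u × end₂ e ≡ w) ⊎ (end₂ e ≡ u × end₁ e ≡ w)

  Incident : E → V → Set
  Incident e v = (end₁ e ≡ v) ⊎ (end₂ e ≡ v)

  data Walk (ES : E → Set) : V → V → Set where
    nil  : ∀ {u} → Walk ES u u
    cons : ∀ {u w v} (e : E) → ES e → Joins e u w → Walk ES w v → Walk ES u v

  verts : ∀ {ES u v} → Walk ES u v → List V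
  verts {u = u} nil = u ∷ []
  verts {u = u} (cons e _ _ p) = u ∷ verts p

  edges : ∀ {ES u v} → Walk ES u v → List E
  edges nil = []
  edges (cons e _ _ p) = e ∷ edges p

  IsPath : ∀ {ES u v} → Walk ES u v → Set
  IsPath p = Unique (verts p)

  IsCycle : ∀ {ES u} → Walk ES u u → Set
  IsCycle nil = ⊥
  IsCycle (cons e x j p) = Unique (verts p) × Unique (edges (cons e x j p))

  Loopless : Set
  Loopless = ∀ e → end₁ e ≢ end₂ e

  Connected : Set
  Connected = ∀ u v → Walk (λ _ → ⊤) u v

  record IsTree (VS : V → Set) (ES : E → Set) : Set where
    field
      ends-in   : ∀ e → ES e → VS (end₁ e) × VS (end₂ e)
      nonempty  : Σ V VS
      connected : ∀ u v → VS u → VS v → Walk ES u v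
      acyclic   : ∀ u (c : Walk ES u u) → ¬ IsCycle c

  IsInterior : (E → Set) → V → Set
  IsInterior ES v = Σ E λ e → Σ E λ e' →
    e ≢ e' × ES e × ES e' × Incident e v × Incident e' v

  record SubTree : Set₁ where
    field
      VS   : V → Set
      ES   : E → Set
      tree : IsTree VS ES

  open SubTree

  IsSteiner : (V → Set) → SubTree → Set
  IsSteiner R T = (∀ v → R v → VS T v)
                × (∀ v → VS T v → ¬ IsInterior (ES T) v → R v)

  -- pendant : L(T) = R  (given Steiner, amounts to R ∩ int(T) = ∅)
  IsPendant : (V → Set) → SubTree → Set
  IsPendant R T = IsSteiner R T × (∀ v → R v → ¬ IsInterior (ES T) v)

  IsNonPendant : (V → Set) → SubTree → Set
  IsNonPendant R T = IsSteiner R T × Σ V (λ v → R v × IsInterior (ES T) v)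

  CompletelyIndependent : (R : V → Set) (k : ℕ) → (Fin k → SubTree) → Set
  CompletelyIndependent R k T =
    ∀ u v → R u → R v → u ≢ v → ∀ i j → i ≢ j →
    (P : Walk (ES (T i)) u v) → IsPath P →
    (Q : Walk (ES (T j)) u v) → IsPath Q →
      (∀ e → e ∈ edges P → e ∈ edges Q → ⊥)
    × (∀ x → x ∈ verts P → x ∈ verts Q → x ≢ u → x ≢ v → ⊥)

  PendantCIST : (R : V → Set) (k : ℕ) → Set₁
  PendantCIST R k = Σ (Fin k → SubTree) λ T →
    (∀ i → IsPendant R (T i)) × CompletelyIndependent R k T

  NonPendantCIST : (R : V → Set) (k : ℕ) → Set₁
  NonPendantCIST R k = Σ (Fin k → SubTree) λ T →
    (∀ i → IsNonPendant R (T i)) × CompletelyIndependent R k T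

  IsSpanningArborescence : (E → Set) → Set
  IsSpanningArborescence AS =
    IsTree (λ _ → ⊤) AS
    × Σ V λ root →
        (∀ a → AS a → end₂ a ≡ root → ⊥)
      × (∀ v → v ≢ root →
           Σ E λ a → AS a × end₂ a ≡ v × (∀ a' → AS a' → end₂ a' ≡ v → a' ≡ a))

  CISA : ℕ → Set₁
  CISA k = Σ (Fin k → (E → Set)) λ T →
      (∀ i → IsSpanningArborescence (T i))
    × (∀ i j → i ≢ j →
          (∀ v → IsInterior (T i) v → IsInterior (T j) v → ⊥)
        × (∀ a → T i a → T j a → ⊥))

-- Directed R-minors.  The terminal set R is given by an injective
-- enumeration term : Fin r → V, and a partition P = {V_1,…,V_r} of V(G)
-- by its class map f : V → Fin r (V_i = f⁻¹(i)).

module _ (G : Multigraph) {r : ℕ} (term : Fin r → Multigraph.V G) where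
  open Multigraph G

  InR : V → Set
  InR v = Σ (Fin r) λ i → term i ≡ v

  -- |V_i ∩ R| = 1 (the terminal of V_i is term i) and G[V_i] connected
  IsRPartition : (V → Fin r) → Set
  IsRPartition f =
      (∀ i → f (term i) ≡ i)
    × (∀ i u v → f u ≡ i → f v ≡ i →
         Walk G (λ e → f (end₁ e) ≡ i × f (end₂ e) ≡ i) u v)

  module _ (f : V → Fin r) where
    tailV headV : E × Bool → V
    tailV (e , b) = if b then end₁ e else end₂ e
    headV (e , b) = if b then end₂ e else end₁ e

    -- one arc (V_i , V_j), i ≠ j, for each edge joining a vertex of V_i
    -- to the terminal of V_j
    MinorArc : Set
    MinorArc = Σ (E × Bool) λ eb →
      f (tailV eb) ≢ f (headV eb) × headV eb ≡ term (f (headV eb))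

    DirectedRMinor : Multigraph
    DirectedRMinor = record
      { V = Fin r
      ; E = MinorArc
      ; end₁ = λ a → f (tailV (proj₁ a))
      ; end₂ = λ a → f (headV (proj₁ a))
      }

{-# OPTIONS --safe #-}
module Submission where

-- Root each tree Tᵢ at a terminal ρᵢ such that distinct trees get distinct roots and ρᵢ lies
-- strictly inside no terminal path of another tree: in the pendant case the i-th terminal
-- (terminals are leaves of every tree), in the non-pendant case a terminal interior to Tᵢ, which
-- lies strictly inside the Tᵢ-path between two other terminals. Complete independence only compares
-- paths with the same ends, but a tripod argument upgrades it: no vertex lies strictly inside
-- terminal paths of two different trees, and no edge lies on terminal paths of two different trees.
-- So it is unambiguous to put a vertex that lies strictly inside a root path into the class of the
-- last terminal before it; terminals form their own classes, and the remaining vertices join a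
-- neighbouring class by breadth-first search. For each terminal t ≠ ρᵢ, the last edge of the
-- Tᵢ-path from ρᵢ to t then becomes an arc of the minor from the last terminal before t to t. Depth
-- along these paths strictly increases, so the arcs of Tᵢ form a spanning arborescence rooted at
-- ρᵢ. Its interior vertices are ρᵢ or lie strictly inside a path of Tᵢ, and each arc comes from an
-- edge of Tᵢ. The separation above thus makes the arborescences of different trees internally
-- disjoint and arc-disjoint.

open import Defs
open import Data.Nat using (ℕ; zero; suc; _≤_; _<_; z≤n; s≤s; _+_; _≤′_; ≤′-refl; ≤′-step)
open import Data.Fin using (Fin; zero; suc; _≟_; inject≤)
open import Data.Product using (Σ; _×_; _,_; proj₁; proj₂)
open import Data.Sum using (_⊎_; inj₁; inj₂; [_,_]′)
import Data.Sum as Sum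
open import Data.Unit using (⊤; tt)
open import Data.Bool using (Bool; true; false)
open import Data.Empty using (⊥; ⊥-elim)
open import Data.List using (List; []; _∷_; _++_; _∷ʳ_; length; lookup; reverse; foldl)
open import Data.List.Properties using (++-assoc; unfold-reverse; foldl-∷ʳ; length-++)
open import Data.List.Membership.Propositional using (_∈_; _∉_)
open import Data.List.Membership.Propositional.Properties using (∈-++⁺ˡ; ∈-++⁺ʳ; ∈-++⁻; ∈-lookup)
open import Data.List.Relation.Unary.Any using (here; there)
import Data.List.Relation.Unary.Any.Properties as Any
open import Data.List.Relation.Unary.All.Properties.Core using (¬Any⇒All¬)
open import Data.List.Relation.Unary.All using ([])
open import Data.List.Relation.Unary.AllPairs using ([]; _∷_)
import Data.List.Relation.Unary.AllPairs as AllPairs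
open import Data.List.Relation.Unary.Unique.Propositional using (Unique)
open import Data.List.Relation.Unary.Unique.Propositional.Properties using (++⁺; Unique[x∷xs]⇒x∉xs)
open import Data.List.Relation.Binary.Permutation.Setoid.Properties using (Unique-resp-↭)
open import Data.List.Relation.Binary.Disjoint.Propositional using (Disjoint)
open import Data.List.Relation.Binary.Permutation.Propositional using (↭-sym; ↭⇒↭ₛ)
open import Data.List.Relation.Binary.Permutation.Propositional.Properties using (↭-reverse)
open import Data.Fin.Properties using (injective⇒≤; any?; inject≤-injective)
open import Data.Nat.Properties
  using (≤-refl; ≤-trans; <⇒≤; <-irrefl; <-≤-trans; ≤-pred; ≤-total; ≤⇒≤′; +-suc; m<m+n; module ≤-Reasoning)
open import Data.Maybe using (Maybe; just; nothing; _<∣>_)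
open import Data.Maybe.Properties using (just-injective)
open import Relation.Binary.PropositionalEquality
open import Relation.Nullary using (¬_; Dec; yes; no; ¬?)
open import Relation.Nullary.Decidable using (_×-dec_; decidable-stable)
open import Function.Definitions using (Injective)
open import Relation.Binary.Definitions using (DecidableEquality)
open import Function using (_∘_)

module _ {A : Set} where

  ∉⇒Unique-∷ : ∀ {x : A} {xs} → x ∉ xs → Unique xs → Unique (x ∷ xs)
  ∉⇒Unique-∷ x∉xs u = ¬Any⇒All¬ _ x∉xs ∷ u

  Unique-++⁻ : ∀ (xs : List A) {ys} → Unique (xs ++ ys) → Unique xs × Unique ys × Disjoint xs ys
  Unique-++⁻ [] u = [] , u , λ ()
  Unique-++⁻ (x ∷ xs) (x∉ ∷ u) with Unique-++⁻ xs u
  ... | uxs , uys , disj =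
    ∉⇒Unique-∷ (λ m → Unique[x∷xs]⇒x∉xs (x∉ ∷ u) (∈-++⁺ˡ m)) uxs , uys ,
    λ { (here refl , m) → Unique[x∷xs]⇒x∉xs (x∉ ∷ u) (∈-++⁺ʳ xs m)
      ; (there m , m′) → disj (m , m′) }

  Unique-reverse : ∀ {xs : List A} → Unique xs → Unique (reverse xs)
  Unique-reverse {xs} = Unique-resp-↭ (setoid A) (↭⇒↭ₛ (↭-sym (↭-reverse xs)))

  lookup-injective : ∀ (xs : List A) → Unique xs → ∀ p q → lookup xs p ≡ lookup xs q → p ≡ q
  lookup-injective (x ∷ xs) u zero zero _ = refl
  lookup-injective (x ∷ xs) u zero (suc q) eq = ⊥-elim (Unique[x∷xs]⇒x∉xs u (subst (_∈ xs) (sym eq) (∈-lookup q)))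
  lookup-injective (x ∷ xs) u (suc p) zero eq = ⊥-elim (Unique[x∷xs]⇒x∉xs u (subst (_∈ xs) eq (∈-lookup p)))
  lookup-injective (x ∷ xs) (_ ∷ u) (suc p) (suc q) eq = cong suc (lookup-injective xs u p q eq)

Unique⇒length≤ : ∀ {n} (xs : List (Fin n)) → Unique xs → length xs ≤ n
Unique⇒length≤ xs u = injective⇒≤ (lookup-injective xs u _ _)

module Walks (G : Multigraph) where
  open Multigraph G

  private variable
    ES : E → Set
    u v w x y : V
    e : E

  Joins-sym : Joins G e u w → Joins G e w u
  Joins-sym (inj₁ (p , q)) = inj₂ (q , p)
  Joins-sym (inj₂ (p , q)) = inj₁ (q , p)

  Joins⇒Incidentˡ : Joins G e u w → Incident G e u
  Joins⇒Incidentˡ (inj₁ (p , _)) = inj₁ p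
  Joins⇒Incidentˡ (inj₂ (p , _)) = inj₂ p

  Joins⇒Incidentʳ : Joins G e u w → Incident G e w
  Joins⇒Incidentʳ (inj₁ (_ , q)) = inj₂ q
  Joins⇒Incidentʳ (inj₂ (_ , q)) = inj₁ q

  Incident⇒endpoint : Joins G e u w → Incident G e x → x ≡ u ⊎ x ≡ w
  Incident⇒endpoint (inj₁ (p , q)) (inj₁ r) = inj₁ (trans (sym r) p)
  Incident⇒endpoint (inj₁ (p , q)) (inj₂ r) = inj₂ (trans (sym r) q)
  Incident⇒endpoint (inj₂ (p , q)) (inj₁ r) = inj₂ (trans (sym r) q)
  Incident⇒endpoint (inj₂ (p , q)) (inj₂ r) = inj₁ (trans (sym r) p)

  Incident⇒Joins : Incident G e x → Σ V λ y → Joins G e y x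
  Incident⇒Joins {e} (inj₁ p) = end₂ e , inj₂ (refl , p)
  Incident⇒Joins {e} (inj₂ p) = end₁ e , inj₁ (refl , p)

  Joins⇒distinct : Loopless G → Joins G e u w → u ≢ w
  Joins⇒distinct loopless (inj₁ (p , q)) u≡w = loopless _ (trans p (trans u≡w (sym q)))
  Joins⇒distinct loopless (inj₂ (p , q)) u≡w = loopless _ (trans q (trans (sym u≡w) (sym p)))

  infixr 5 _++ʷ_
  _++ʷ_ : Walk G ES u w → Walk G ES w v → Walk G ES u v
  nil ++ʷ q = q
  cons e s j p ++ʷ q = cons e s j (p ++ʷ q)

  ++ʷ-assoc : ∀ {a b c d} (p : Walk G ES a b) (q : Walk G ES b c) (t : Walk G ES c d) →
              (p ++ʷ q) ++ʷ t ≡ p ++ʷ (q ++ʷ t)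
  ++ʷ-assoc nil q t = refl
  ++ʷ-assoc (cons e s j p) q t = cong (cons e s j) (++ʷ-assoc p q t)

  step : (e : E) → ES e → Joins G e u w → Walk G ES u w
  step e s j = cons e s j nil

  IsPath-step : Loopless G → (s : ES e) (j : Joins G e u w) → IsPath G (step {ES = ES} e s j)
  IsPath-step loopless s j = ∉⇒Unique-∷ (λ { (here refl) → Joins⇒distinct loopless j refl }) ([] ∷ [])

  ++ʷ-step-nonempty : (p : Walk G ES u y) (s : ES e) (j : Joins G e y w) → 0 < length (edges G (p ++ʷ step e s j))
  ++ʷ-step-nonempty nil s j = s≤s z≤n
  ++ʷ-step-nonempty (cons _ _ _ p) s j = s≤s z≤n

  reverseʷ : Walk G ES u v → Walk G ES v u
  reverseʷ nil = nil
  reverseʷ (cons e s j p) = reverseʷ p ++ʷ step e s (Joins-sym j)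

  initVerts : Walk G ES u v → List V
  initVerts nil = []
  initVerts {u = u} (cons e s j p) = u ∷ initVerts p

  verts≡initVerts∷ʳ : (p : Walk G ES u v) → verts G p ≡ initVerts p ∷ʳ v
  verts≡initVerts∷ʳ nil = refl
  verts≡initVerts∷ʳ {u = u} (cons e s j p) = cong (u ∷_) (verts≡initVerts∷ʳ p)

  verts-++ʷ : (p : Walk G ES u w) (q : Walk G ES w v) → verts G (p ++ʷ q) ≡ initVerts p ++ verts G q
  verts-++ʷ nil q = refl
  verts-++ʷ {u = u} (cons e s j p) q = cong (u ∷_) (verts-++ʷ p q)

  edges-++ʷ : (p : Walk G ES u w) (q : Walk G ES w v) → edges G (p ++ʷ q) ≡ edges G p ++ edges G q
  edges-++ʷ nil q = refl
  edges-++ʷ (cons e s j p) q = cong (e ∷_) (edges-++ʷ p q)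

  verts-++ʷ-step : (p : Walk G ES u y) (s : ES e) (j : Joins G e y w) →
                   verts G (p ++ʷ step e s j) ≡ verts G p ∷ʳ w
  verts-++ʷ-step {y = y} {w = w} p s j = begin
    verts G (p ++ʷ step _ s j)     ≡⟨ verts-++ʷ p (step _ s j) ⟩
    initVerts p ++ y ∷ w ∷ []      ≡⟨ ++-assoc (initVerts p) (y ∷ []) (w ∷ []) ⟨
    (initVerts p ∷ʳ y) ∷ʳ w        ≡⟨ cong (_∷ʳ w) (verts≡initVerts∷ʳ p) ⟨
    verts G p ∷ʳ w                 ∎
    where open ≡-Reasoning

  verts-reverseʷ : (p : Walk G ES u v) → verts G (reverseʷ p) ≡ reverse (verts G p)
  verts-reverseʷ nil = refl
  verts-reverseʷ {u = u} (cons e s j p) = begin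
    verts G (reverseʷ p ++ʷ step e s (Joins-sym j))   ≡⟨ verts-++ʷ-step (reverseʷ p) s (Joins-sym j) ⟩
    verts G (reverseʷ p) ∷ʳ u                         ≡⟨ cong (_∷ʳ u) (verts-reverseʷ p) ⟩
    reverse (verts G p) ∷ʳ u                          ≡⟨ unfold-reverse u (verts G p) ⟨
    reverse (u ∷ verts G p)                           ∎
    where open ≡-Reasoning

  edges-reverseʷ : (p : Walk G ES u v) → edges G (reverseʷ p) ≡ reverse (edges G p)
  edges-reverseʷ nil = refl
  edges-reverseʷ (cons e s j p) = begin
    edges G (reverseʷ p ++ʷ step e s (Joins-sym j))   ≡⟨ edges-++ʷ (reverseʷ p) (step e s (Joins-sym j)) ⟩
    edges G (reverseʷ p) ∷ʳ e                         ≡⟨ cong (_∷ʳ e) (edges-reverseʷ p) ⟩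
    reverse (edges G p) ∷ʳ e                          ≡⟨ unfold-reverse e (edges G p) ⟨
    reverse (e ∷ edges G p)                           ∎
    where open ≡-Reasoning

  start∈verts : (p : Walk G ES u v) → u ∈ verts G p
  start∈verts nil = here refl
  start∈verts (cons e s j p) = here refl

  end∈verts : (p : Walk G ES u v) → v ∈ verts G p
  end∈verts nil = here refl
  end∈verts (cons e s j p) = there (end∈verts p)

  ∈-verts-++ʷ⁻ : (p : Walk G ES u w) (q : Walk G ES w v) →
                 x ∈ verts G (p ++ʷ q) → x ∈ verts G p ⊎ x ∈ verts G q
  ∈-verts-++ʷ⁻ nil q m = inj₂ m
  ∈-verts-++ʷ⁻ (cons e s j p) q (here refl) = inj₁ (here refl)
  ∈-verts-++ʷ⁻ (cons e s j p) q (there m) = Sum.map₁ there (∈-verts-++ʷ⁻ p q m)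

  ∈-verts-++ʷ⁺ˡ : (p : Walk G ES u w) (q : Walk G ES w v) → x ∈ verts G p → x ∈ verts G (p ++ʷ q)
  ∈-verts-++ʷ⁺ˡ nil q (here refl) = start∈verts q
  ∈-verts-++ʷ⁺ˡ (cons e s j p) q (here refl) = here refl
  ∈-verts-++ʷ⁺ˡ (cons e s j p) q (there m) = there (∈-verts-++ʷ⁺ˡ p q m)

  ∈-verts-++ʷ⁺ʳ : (p : Walk G ES u w) (q : Walk G ES w v) → x ∈ verts G q → x ∈ verts G (p ++ʷ q)
  ∈-verts-++ʷ⁺ʳ p q m = subst (_ ∈_) (sym (verts-++ʷ p q)) (∈-++⁺ʳ (initVerts p) m)

  ∈-edges-++ʷ⁻ : ∀ {f} (p : Walk G ES u w) (q : Walk G ES w v) →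
                 f ∈ edges G (p ++ʷ q) → f ∈ edges G p ⊎ f ∈ edges G q
  ∈-edges-++ʷ⁻ p q m = ∈-++⁻ (edges G p) (subst (_ ∈_) (edges-++ʷ p q) m)

  ∈-edges-++ʷ⁺ʳ : ∀ {f} (p : Walk G ES u w) (q : Walk G ES w v) → f ∈ edges G q → f ∈ edges G (p ++ʷ q)
  ∈-edges-++ʷ⁺ʳ p q m = subst (_ ∈_) (sym (edges-++ʷ p q)) (∈-++⁺ʳ (edges G p) m)

  ∈-verts-reverseʷ⁺ : (p : Walk G ES u v) → x ∈ verts G p → x ∈ verts G (reverseʷ p)
  ∈-verts-reverseʷ⁺ p m = subst (_ ∈_) (sym (verts-reverseʷ p)) (Any.reverse⁺ m)

  ∈-verts-reverseʷ⁻ : (p : Walk G ES u v) → x ∈ verts G (reverseʷ p) → x ∈ verts G p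
  ∈-verts-reverseʷ⁻ p m = Any.reverse⁻ (subst (_ ∈_) (verts-reverseʷ p) m)

  ∈-edges-reverseʷ⁺ : ∀ {f} (p : Walk G ES u v) → f ∈ edges G p → f ∈ edges G (reverseʷ p)
  ∈-edges-reverseʷ⁺ p m = subst (_ ∈_) (sym (edges-reverseʷ p)) (Any.reverse⁺ m)

  IsPath-reverseʷ : (p : Walk G ES u v) → IsPath G p → IsPath G (reverseʷ p)
  IsPath-reverseʷ p up = subst Unique (sym (verts-reverseʷ p)) (Unique-reverse up)

  endpoint∈verts : (p : Walk G ES u v) → e ∈ edges G p → Incident G e x → x ∈ verts G p
  endpoint∈verts (cons e s j p) (here refl) i with Incident⇒endpoint j i
  ... | inj₁ refl = here refl
  ... | inj₂ refl = there (start∈verts p)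
  endpoint∈verts (cons e s j p) (there m) i = there (endpoint∈verts p m i)

  ∈-edges⇒ES : (p : Walk G ES u v) → e ∈ edges G p → ES e
  ∈-edges⇒ES (cons e s j p) (here refl) = s
  ∈-edges⇒ES (cons e s j p) (there m) = ∈-edges⇒ES p m

  IsPath⇒Unique-edges : (p : Walk G ES u v) → IsPath G p → Unique (edges G p)
  IsPath⇒Unique-edges nil _ = []
  IsPath⇒Unique-edges (cons e s j p) up@(_ ∷ up′) =
    ∉⇒Unique-∷ (λ m → Unique[x∷xs]⇒x∉xs up (endpoint∈verts p m (Joins⇒Incidentˡ j)))
               (IsPath⇒Unique-edges p up′)

  IsPath-++ʷ-step⁻ : (p : Walk G ES u y) (s : ES e) (j : Joins G e y w) →
                     IsPath G (p ++ʷ step e s j) → IsPath G p × w ∉ verts G p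
  IsPath-++ʷ-step⁻ p s j up with Unique-++⁻ (verts G p) (subst Unique (verts-++ʷ-step p s j) up)
  ... | up′ , _ , disj = up′ , λ m → disj (m , here refl)

  IsPath-closed⇒trivial : (p : Walk G ES u u) → IsPath G p → x ∈ verts G p → x ≡ u
  IsPath-closed⇒trivial nil _ (here eq) = eq
  IsPath-closed⇒trivial (cons e s j p) up _ = ⊥-elim (Unique[x∷xs]⇒x∉xs up (end∈verts p))

  IsPath⇒ends-distinct : (p : Walk G ES u v) → IsPath G p → x ∈ verts G p → x ≢ u → u ≢ v
  IsPath⇒ends-distinct p up m x≢u refl = x≢u (IsPath-closed⇒trivial p up m)

  IsPath⇒ends-distinct-edge : Loopless G → (p : Walk G ES u v) → IsPath G p → e ∈ edges G p → u ≢ v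
  IsPath⇒ends-distinct-edge loopless p up m refl =
    loopless _ (trans (IsPath-closed⇒trivial p up (endpoint∈verts p m (inj₁ refl)))
                 (sym (IsPath-closed⇒trivial p up (endpoint∈verts p m (inj₂ refl)))))

  IsPath⇒IsInterior : (p : Walk G ES u v) → IsPath G p → x ∈ verts G p →
                      x ≢ u → x ≢ v → IsInterior G ES x
  IsPath⇒IsInterior nil _ (here eq) x≢u _ = ⊥-elim (x≢u eq)
  IsPath⇒IsInterior (cons e s j p) _ (here eq) x≢u _ = ⊥-elim (x≢u eq)
  IsPath⇒IsInterior (cons e s j nil) _ (there (here eq)) _ x≢v = ⊥-elim (x≢v eq)
  IsPath⇒IsInterior (cons e s j (cons e′ s′ j′ p)) up (there (here refl)) x≢u _ =
    e , e′ , e≢e′ , s , s′ , Joins⇒Incidentʳ j , Joins⇒Incidentˡ j′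
    where
      e≢e′ : e ≢ e′
      e≢e′ refl with Incident⇒endpoint j′ (Joins⇒Incidentˡ j)
      ... | inj₁ eq = x≢u (sym eq)
      ... | inj₂ refl = Unique[x∷xs]⇒x∉xs up (there (start∈verts p))
  IsPath⇒IsInterior (cons e s j p@(cons _ _ _ _)) (_ ∷ up) (there (there m)) _ x≢v =
    IsPath⇒IsInterior p up (there m) (λ { refl → Unique[x∷xs]⇒x∉xs up m }) x≢v

  splitAt : (p : Walk G ES u v) → x ∈ verts G p →
            Σ (Walk G ES u x) λ A → Σ (Walk G ES x v) λ B → p ≡ A ++ʷ B
  splitAt nil (here refl) = nil , nil , refl
  splitAt (cons e s j p) (here refl) = nil , cons e s j p , refl
  splitAt (cons e s j p) (there m) with splitAt p m
  ... | A , B , eq = cons e s j A , B , cong (cons e s j) eq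

  IsPath-++ʷ⁻ : (p : Walk G ES u w) (q : Walk G ES w v) → IsPath G (p ++ʷ q) → IsPath G p × IsPath G q
  IsPath-++ʷ⁻ p q up with Unique-++⁻ (initVerts p) (subst Unique (verts-++ʷ p q) up)
  ... | up′ , uq , disj =
    subst Unique (sym (verts≡initVerts∷ʳ p)) (++⁺ up′ ([] ∷ []) λ { (m , here refl) → disj (m , start∈verts q) }) ,
    uq

  record Snoc (p : Walk G ES u v) : Set where
    constructor snoc
    field
      {penultimate} : V
      init          : Walk G ES u penultimate
      lastEdge      : E
      lastEdge∈     : ES lastEdge
      lastJoins     : Joins G lastEdge penultimate v
      split         : p ≡ init ++ʷ step lastEdge lastEdge∈ lastJoins

  private
    snoc-cons : (e : E) (s : ES e) (j : Joins G e u w) (p : Walk G ES w v) → Snoc (cons e s j p)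
    snoc-cons e s j nil = snoc nil e s j refl
    snoc-cons e s j (cons e′ s′ j′ p) with snoc-cons e′ s′ j′ p
    ... | snoc A f t jf eq = snoc (cons e s j A) f t jf (cong (cons e s j) eq)

  snocView : (p : Walk G ES u v) → u ≢ v → Snoc p
  snocView nil u≢v = ⊥-elim (u≢v refl)
  snocView (cons e s j p) _ = snoc-cons e s j p

module TreePaths (G : Multigraph) (_≟V_ : DecidableEquality (Multigraph.V G))
                 (_≟E_ : DecidableEquality (Multigraph.E G)) where
  open Multigraph G
  open Walks G
  open import Data.List.Membership.DecPropositional _≟V_ using (_∈?_)

  private variable
    VS : V → Set
    ES : E → Set
    u v w x : V

  IsTree-no-detour : IsTree G VS ES → ∀ {y₁ y₂ e₁ e₂} → ES e₁ → ES e₂ → e₁ ≢ e₂ →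
                     Joins G e₁ x y₁ → Joins G e₂ y₂ x →
                     (p : Walk G ES y₁ y₂) → IsPath G p → x ∉ verts G p → ⊥
  IsTree-no-detour {x = x} T {e₁ = e₁} {e₂} s₁ s₂ e₁≢e₂ j₁ j₂ p up x∉p =
    IsTree.acyclic T x (cons e₁ s₁ j₁ (p ++ʷ step e₂ s₂ j₂)) (verts-unique , edges-unique)
    where
      verts-unique : Unique (verts G (p ++ʷ step e₂ s₂ j₂))
      verts-unique = subst Unique (sym (verts-++ʷ-step p s₂ j₂))
        (++⁺ up ([] ∷ []) λ { (m , here refl) → x∉p m })
      e∉p : ∀ {e} → Incident G e x → e ∉ edges G p
      e∉p i m = x∉p (endpoint∈verts p m i)
      edges-unique : Unique (e₁ ∷ edges G (p ++ʷ step e₂ s₂ j₂))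
      edges-unique = subst (λ es → Unique (e₁ ∷ es)) (sym (edges-++ʷ p (step e₂ s₂ j₂)))
        (∉⇒Unique-∷ ([ e∉p (Joins⇒Incidentˡ j₁) , (λ { (here eq) → e₁≢e₂ eq }) ]′ ∘ ∈-++⁻ (edges G p))
                   (++⁺ (IsPath⇒Unique-edges p up) ([] ∷ [])
                        λ { (m , here refl) → e∉p (Joins⇒Incidentʳ j₂) m }))

  Incident⇒VS : IsTree G VS ES → ∀ {e} → ES e → Incident G e x → VS x
  Incident⇒VS T s (inj₁ refl) = proj₁ (IsTree.ends-in T _ s)
  Incident⇒VS T s (inj₂ refl) = proj₂ (IsTree.ends-in T _ s)

  IsTree-prepend : IsTree G VS ES → ∀ {z′ z w f g} (sg : ES g) (jg : Joins G g z w) (rest : Walk G ES w v) →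
                   IsPath G (cons g sg jg rest) → (sf : ES f) (jf : Joins G f z′ z) → f ≢ g →
                   IsPath G (cons f sf jf (cons g sg jg rest))
  IsTree-prepend T {z′ = z′} {z = z} sg jg rest up sf jf f≢g = ∉⇒Unique-∷ z′∉ up
    where
      z′∉ : z′ ∉ verts G (cons _ sg jg rest)
      z′∉ (here refl) = IsTree.acyclic T z (cons _ sf jf nil) (([] ∷ []) , ([] ∷ []))
      z′∉ (there m) with splitAt rest m
      ... | A , B , refl = IsTree-no-detour T sg sf (f≢g ∘ sym) jg jf A
        (proj₁ (IsPath-++ʷ⁻ A B (AllPairs.tail up)))
        (λ z∈A → Unique[x∷xs]⇒x∉xs up (∈-verts-++ʷ⁺ˡ A B z∈A))

  record PathAlong (p : Walk G ES u v) : Set where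
    field
      path   : Walk G ES u v
      isPath : IsPath G path
      verts⊆ : ∀ {y} → y ∈ verts G path → y ∈ verts G p
      edges⊆ : ∀ {f} → f ∈ edges G path → f ∈ edges G p

  pathAlong : (p : Walk G ES u v) → PathAlong p
  pathAlong nil = record { path = nil ; isPath = [] ∷ [] ; verts⊆ = λ m → m ; edges⊆ = λ m → m }
  pathAlong {u = u} (cons e s j p) with pathAlong p
  ... | record { path = q ; isPath = uq ; verts⊆ = vq ; edges⊆ = eq } with u ∈? verts G q
  ...   | yes m with splitAt q m
  ...     | A , B , refl = record
    { path   = B
    ; isPath = proj₂ (IsPath-++ʷ⁻ A B uq)
    ; verts⊆ = λ m′ → there (vq (∈-verts-++ʷ⁺ʳ A B m′))
    ; edges⊆ = λ m′ → there (eq (∈-edges-++ʷ⁺ʳ A B m′))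
    }
  pathAlong (cons e s j p) | record { path = q ; isPath = uq ; verts⊆ = vq ; edges⊆ = eq } | no u∉q = record
    { path   = cons e s j q
    ; isPath = ∉⇒Unique-∷ u∉q uq
    ; verts⊆ = λ { (here refl) → here refl ; (there m) → there (vq m) }
    ; edges⊆ = λ { (here refl) → here refl ; (there m) → there (eq m) }
    }

  private
    Joins-functional : ∀ {e w′} → Joins G e u w → Joins G e u w′ → u ≢ w → w ≡ w′
    Joins-functional (inj₁ (_ , q)) (inj₁ (_ , q′)) _ = trans (sym q) q′
    Joins-functional (inj₁ (p , q)) (inj₂ (p′ , _)) u≢w = ⊥-elim (u≢w (trans (sym p′) q))
    Joins-functional (inj₂ (p , q)) (inj₁ (p′ , _)) u≢w = ⊥-elim (u≢w (trans (sym p′) q))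
    Joins-functional (inj₂ (_ , q)) (inj₂ (_ , q′)) _ = trans (sym q) q′

  tree-path-unique : IsTree G VS ES → (p q : Walk G ES u v) → IsPath G p → IsPath G q →
                     verts G p ≡ verts G q × edges G p ≡ edges G q
  tree-path-unique T nil nil _ _ = refl , refl
  tree-path-unique T nil (cons e s j q) _ uq = ⊥-elim (Unique[x∷xs]⇒x∉xs uq (end∈verts q))
  tree-path-unique T (cons e s j p) nil up _ = ⊥-elim (Unique[x∷xs]⇒x∉xs up (end∈verts p))
  tree-path-unique {u = u} T (cons e s j p) (cons e′ s′ j′ q) up@(_ ∷ up′) (_ ∷ uq′) with e ≟E e′
  ... | yes refl with Joins-functional j j′ (λ eq → Unique[x∷xs]⇒x∉xs up (subst (_∈ verts G p) (sym eq) (start∈verts p)))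
  ...   | refl with tree-path-unique T p q up′ uq′
  ...     | vs , es = cong (u ∷_) vs , cong (e ∷_) es
  tree-path-unique {u = u} T (cons e s j p) (cons e′ s′ j′ q) up uq | no e≢e′ =
    ⊥-elim (IsTree-no-detour T s s′ e≢e′ j (Joins-sym j′) (path L) (isPath L) u∉L)
    where
      L = pathAlong (p ++ʷ reverseʷ q)
      open PathAlong
      u∉L : u ∉ verts G (path L)
      u∉L m with ∈-verts-++ʷ⁻ p (reverseʷ q) (verts⊆ L m)
      ... | inj₁ m′ = Unique[x∷xs]⇒x∉xs up m′
      ... | inj₂ m′ = Unique[x∷xs]⇒x∉xs uq (∈-verts-reverseʷ⁻ q m′)

-- S a b says that a fixed vertex or edge lies strictly between a and b in a tree, and Ok c that it
-- is not c itself.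
record Splitting {T : Set} (Ok : T → Set) (S : T → T → Set) : Set where
  field
    ends-ok   : ∀ {a b} → S a b → Ok a × Ok b
    symmetric : ∀ {a b} → S a b → S b a
    split     : ∀ {a b} c → Ok c → S a b → S a c ⊎ S c b

module _ {T : Set} {Ok : T → Set} {S₁ S₂ : T → T → Set}
         (P₁ : Splitting Ok S₁) (P₂ : Splitting Ok S₂)
         (clash : ∀ {a b} → S₁ a b → S₂ a b → ⊥) where
  private
    module P₁ = Splitting P₁
    module P₂ = Splitting P₂

    disjoint-from : ∀ {a b p} → S₁ a b → S₂ a p → ⊥
    disjoint-from {a} {b} {p} s₁ s₂
      with P₁.split p (proj₂ (P₂.ends-ok s₂)) s₁ | P₂.split b (proj₂ (P₁.ends-ok s₁)) s₂
    ... | inj₁ s₁′ | _         = clash s₁′ s₂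
    ... | inj₂ _   | inj₁ s₂′  = clash s₁ s₂′
    ... | inj₂ s₁′ | inj₂ s₂′  = clash s₁′ (P₂.symmetric s₂′)

  -- Splitting each relation at an endpoint of the other leads to a pair of ends they share.
  splittings-disjoint : ∀ {a b a′ b′} → S₁ a b → S₂ a′ b′ → ⊥
  splittings-disjoint {a} s₁ s₂ with P₂.split a (proj₁ (P₁.ends-ok s₁)) s₂
  ... | inj₁ s₂′ = disjoint-from s₁ (P₂.symmetric s₂′)
  ... | inj₂ s₂′ = disjoint-from s₁ s₂′

module ParentArcs (M : Multigraph) (_≟_ : DecidableEquality (Multigraph.V M))
  (AS : Multigraph.E M → Set) (root : Multigraph.V M) (depth : Multigraph.V M → ℕ)
  (depth-< : ∀ {a} → AS a → depth (Multigraph.end₁ M a) < depth (Multigraph.end₂ M a))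
  (in-unique : ∀ {a a′} → AS a → AS a′ → Multigraph.end₂ M a ≡ Multigraph.end₂ M a′ → a ≡ a′)
  (root-no-in : ∀ {a} → AS a → Multigraph.end₂ M a ≢ root)
  (in-arc : ∀ v → v ≢ root → Σ (Multigraph.E M) λ a → AS a × Multigraph.end₂ M a ≡ v) where
  open Multigraph M
  open Walks M

  private
    InArcAmong : List E → V → Set
    InArcAmong as v = Σ E λ a → a ∈ as × end₂ a ≡ v

    arc-< : ∀ {a x y} → AS a → end₁ a ≡ x → end₂ a ≡ y → depth x < depth y
    arc-< s refl refl = depth-< s

    -- Once an arc has been traversed forwards, a walk with distinct edges can only go on forwards.
    after-arc : ∀ {w v a} → AS a → end₂ a ≡ w → (p : Walk M AS w v) → a ∉ edges M p →
                Unique (edges M p) → depth w ≤ depth v × InArcAmong (a ∷ edges M p) v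
    after-arc s h nil _ _ = ≤-refl , _ , here refl , h
    after-arc s h (cons a′ s′ (inj₁ (t , h′)) p) _ u@(_ ∷ u′) with after-arc s′ h′ p (Unique[x∷xs]⇒x∉xs u) u′
    ... | w≤v , arc , m , h″ = ≤-trans (<⇒≤ (arc-< s′ t h′)) w≤v , arc , there m , h″
    after-arc s h (cons a′ s′ (inj₂ (h′ , _)) p) a∉ _ = ⊥-elim (a∉ (here (in-unique s s′ (trans h (sym h′)))))

    descends-or-enters : ∀ {x v} (p : Walk M AS x v) → Unique (edges M p) →
                         depth v ≤ depth x ⊎ InArcAmong (edges M p) v
    descends-or-enters nil _ = inj₁ ≤-refl
    descends-or-enters (cons a s (inj₁ (t , h)) p) u@(_ ∷ u′) = inj₂ (proj₂ (after-arc s h p (Unique[x∷xs]⇒x∉xs u) u′))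
    descends-or-enters (cons a s (inj₂ (h , t)) p) (_ ∷ u′) with descends-or-enters p u′
    ... | inj₁ v≤y = inj₁ (≤-trans v≤y (<⇒≤ (arc-< s t h)))
    ... | inj₂ (a′ , m , h′) = inj₂ (a′ , there m , h′)

    acyclic : ∀ u (c : Walk M AS u u) → ¬ IsCycle M c
    acyclic u (cons a s (inj₁ (t , h)) p) (_ , ue@(_ ∷ ue′)) =
      <-irrefl refl (<-≤-trans (arc-< s t h) (proj₁ (after-arc s h p (Unique[x∷xs]⇒x∉xs ue) ue′)))
    acyclic u (cons a s (inj₂ (h , t)) p) (_ , ue@(_ ∷ ue′)) with descends-or-enters p ue′
    ... | inj₁ u≤w = <-irrefl refl (<-≤-trans (arc-< s t h) u≤w)
    ... | inj₂ (a′ , m , h′) =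
      Unique[x∷xs]⇒x∉xs ue (subst (_∈ edges M p) (in-unique (∈-edges⇒ES p m) s (trans h′ (sym h))) m)

    descend : ∀ N v → depth v < N → Walk M AS v root
    descend (suc N) v d<N with v ≟ root
    ... | yes refl = nil
    ... | no v≢root with in-arc v v≢root
    ...   | a , s , h = cons a s (inj₂ (h , refl)) (descend N (end₁ a) (<-≤-trans (arc-< s refl h) (≤-pred d<N)))

    toRoot : ∀ v → Walk M AS v root
    toRoot v = descend (suc (depth v)) v ≤-refl

  isSpanningArborescence : IsSpanningArborescence M AS
  isSpanningArborescence =
    record { ends-in = λ _ _ → tt , tt ; nonempty = root , tt
           ; connected = λ u v _ _ → toRoot u ++ʷ reverseʷ (toRoot v) ; acyclic = acyclic } ,
    root , (λ a s h → root-no-in s h) ,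
    λ v v≢root → let a , s , h = in-arc v v≢root in
      a , s , h , λ a′ s′ h′ → in-unique s′ s (trans h′ (sym h))

  interior⇒tail : ∀ {v} → IsInterior M AS v → Σ E λ a → AS a × end₁ a ≡ v
  interior⇒tail (a , _ , _ , s , _ , inj₁ t , _) = a , s , t
  interior⇒tail (_ , a′ , _ , _ , s′ , inj₂ _ , inj₁ t′) = a′ , s′ , t′
  interior⇒tail (a , a′ , a≢a′ , s , s′ , inj₂ h , inj₂ h′) = ⊥-elim (a≢a′ (in-unique s s′ (trans h (sym h′))))

module LabelExtension {n m : ℕ} (e₁ e₂ : Fin m → Fin n) (connected : Connected (mkGraph n m e₁ e₂))
  {L : Set} (seed : Fin n → Maybe L) (v₀ : Fin n) {c₀ : L} (seed-v₀ : seed v₀ ≡ just c₀) where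
  private
    G = mkGraph n m e₁ e₂

    <∣>≡just⁻ : ∀ (mx my : Maybe L) {c} → (mx <∣> my) ≡ just c → mx ≡ just c ⊎ my ≡ just c
    <∣>≡just⁻ (just _) _ eq = inj₁ eq
    <∣>≡just⁻ nothing _ eq = inj₂ eq

    firstJust : ∀ {l} → (Fin l → Maybe L) → Maybe L
    firstJust {zero} h = nothing
    firstJust {suc l} h = h zero <∣> firstJust (h ∘ suc)

    firstJust-sound : ∀ {l} (h : Fin l → Maybe L) {c} → firstJust h ≡ just c → Σ (Fin l) λ i → h i ≡ just c
    firstJust-sound {suc l} h eq with <∣>≡just⁻ (h zero) (firstJust (h ∘ suc)) eq
    ... | inj₁ eq′ = zero , eq′
    ... | inj₂ eq′ = let i , eq″ = firstJust-sound (h ∘ suc) eq′ in suc i , eq″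

    firstJust-complete : ∀ {l} (h : Fin l → Maybe L) i {c} → h i ≡ just c → Σ L λ c′ → firstJust h ≡ just c′
    firstJust-complete h zero {c} eq rewrite eq = c , refl
    firstJust-complete h (suc i) eq with h zero
    ... | just c′ = c′ , refl
    ... | nothing = firstJust-complete (h ∘ suc) i eq

    labelAcross : (Fin n → Maybe L) → Fin n → Fin m → Maybe L
    labelAcross h x e with e₁ e ≟ x | e₂ e ≟ x
    ... | yes _ | _     = h (e₂ e)
    ... | no _  | yes _ = h (e₁ e)
    ... | no _  | no _  = nothing

    labelAcross-sound : ∀ h x e {c} → labelAcross h x e ≡ just c → Σ (Fin n) λ y → Joins G e x y × h y ≡ just c
    labelAcross-sound h x e eq with e₁ e ≟ x | e₂ e ≟ x
    ... | yes p | _     = e₂ e , inj₁ (p , refl) , eq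
    ... | no _  | yes q = e₁ e , inj₂ (q , refl) , eq

    labelAcross-complete : ∀ h x e {y c} → Joins G e x y → h y ≡ just c → Σ L λ c′ → labelAcross h x e ≡ just c′
    labelAcross-complete h x e {c = c} j eq with e₁ e ≟ x | e₂ e ≟ x | j
    ... | yes _ | _     | inj₁ (_ , q) = c , trans (cong h q) eq
    ... | yes p | _     | inj₂ (p′ , q) = c , trans (cong h (trans p′ (trans (sym p) q))) eq
    ... | no p  | _     | inj₁ (p′ , _) = ⊥-elim (p p′)
    ... | no _  | yes _ | inj₂ (_ , q) = c , trans (cong h q) eq
    ... | no _  | no p  | inj₂ (p′ , _) = ⊥-elim (p p′)

    -- Breadth-first search from the seeds: labelWithin l x is defined once x is within distance l
    -- of a seed, and never changes afterwards.
    labelWithin : ℕ → Fin n → Maybe L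
    labelWithin zero = seed
    labelWithin (suc l) x = labelWithin l x <∣> firstJust (labelAcross (labelWithin l) x)

    labelWithin-suc : ∀ l x {c} → labelWithin l x ≡ just c → labelWithin (suc l) x ≡ just c
    labelWithin-suc l x eq rewrite eq = refl

    labelWithin-mono : ∀ {l l′} x {c} → l ≤′ l′ → labelWithin l x ≡ just c → labelWithin l′ x ≡ just c
    labelWithin-mono x ≤′-refl eq = eq
    labelWithin-mono {l′ = suc l′} x (≤′-step l≤l′) eq = labelWithin-suc l′ x (labelWithin-mono x l≤l′ eq)

    reach : ∀ {x y c} (p : Walk G (λ _ → ⊤) x y) → seed y ≡ just c →
            Σ L λ c′ → labelWithin (length (edges G p)) x ≡ just c′
    reach nil eq = _ , eq
    reach {x} (cons e _ j p) eq with labelWithin (length (edges G p)) x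
    ... | just c = c , refl
    ... | nothing = let c , eq′ = labelAcross-complete _ x e j (proj₂ (reach p eq)) in firstJust-complete _ e eq′

    fuel : Fin n → ℕ
    fuel x = length (edges G (connected x v₀))

    found : ∀ x → Σ L λ c → labelWithin (fuel x) x ≡ just c
    found x = reach (connected x v₀) seed-v₀

  label : Fin n → L
  label x = proj₁ (found x)

  private
    labelWithin⇒label : ∀ l x {c} → labelWithin l x ≡ just c → label x ≡ c
    labelWithin⇒label l x eq with ≤-total l (fuel x)
    ... | inj₁ l≤ = just-injective (trans (sym (proj₂ (found x))) (labelWithin-mono x (≤⇒≤′ l≤) eq))
    ... | inj₂ ≤l = just-injective (trans (sym (labelWithin-mono x (≤⇒≤′ ≤l) (proj₂ (found x)))) eq)

  label-seed : ∀ {x c} → seed x ≡ just c → label x ≡ c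
  label-seed = labelWithin⇒label 0 _

  InClass : L → Fin m → Set
  InClass c e = label (e₁ e) ≡ c × label (e₂ e) ≡ c

  Joins⇒InClass : ∀ {e x y c} → Joins G e x y → label x ≡ c → label y ≡ c → InClass c e
  Joins⇒InClass (inj₁ (p , q)) ℓx ℓy = trans (cong label p) ℓx , trans (cong label q) ℓy
  Joins⇒InClass (inj₂ (p , q)) ℓx ℓy = trans (cong label q) ℓy , trans (cong label p) ℓx

  private
    walkWithin : ∀ l x {c} → labelWithin l x ≡ just c → Σ (Fin n) λ y → seed y ≡ just c × Walk G (InClass c) x y
    walkWithin zero x eq = x , eq , nil
    walkWithin (suc l) x eq with <∣>≡just⁻ (labelWithin l x) _ eq
    ... | inj₁ eq′ = walkWithin l x eq′
    ... | inj₂ eq′ with firstJust-sound _ eq′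
    ...   | e , eq″ with labelAcross-sound _ x e eq″
    ...     | y , j , eqy with walkWithin l y eqy
    ...       | z , seed-z , p = z , seed-z ,
      cons e (Joins⇒InClass j (labelWithin⇒label (suc l) x eq) (labelWithin⇒label l y eqy)) j p

  walkToSeed : ∀ x → Σ (Fin n) λ y → seed y ≡ just (label x) × Walk G (InClass (label x)) x y
  walkToSeed x = walkWithin (fuel x) x (proj₂ (found x))

module CIST {n m : ℕ} {e₁ e₂ : Fin m → Fin n} (loopless : Loopless (mkGraph n m e₁ e₂))
  {r : ℕ} {term : Fin r → Fin n} (term-injective : Injective _≡_ _≡_ term)
  {k : ℕ} (T : Fin k → SubTree (mkGraph n m e₁ e₂))
  (steiner : ∀ i → IsSteiner (mkGraph n m e₁ e₂) (InR (mkGraph n m e₁ e₂) term) (T i))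
  (independent : CompletelyIndependent (mkGraph n m e₁ e₂) (InR (mkGraph n m e₁ e₂) term) k T) where

  private
    G = mkGraph n m e₁ e₂
  open Walks G
  open TreePaths G _≟_ _≟_
  open import Data.List.Membership.DecPropositional (_≟_ {n}) using (_∈?_)

  private variable
    i j : Fin k
    a b a′ b′ c : Fin r
    x : Fin n
    e : Fin m

  R : Fin n → Set
  R = InR G term

  R? : ∀ x → Dec (R x)
  R? x = any? λ j → term j ≟ x

  ES : Fin k → Fin m → Set
  ES i = SubTree.ES (T i)

  tree : ∀ i → IsTree G (SubTree.VS (T i)) (ES i)
  tree i = SubTree.tree (T i)

  private
    connection : ∀ i a b → PathAlong (IsTree.connected (tree i) (term a) (term b)
                                        (proj₁ (steiner i) _ (a , refl)) (proj₁ (steiner i) _ (b , refl)))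
    connection i a b = pathAlong _

  path : ∀ i a b → Walk G (ES i) (term a) (term b)
  path i a b = PathAlong.path (connection i a b)

  path-isPath : ∀ i a b → IsPath G (path i a b)
  path-isPath i a b = PathAlong.isPath (connection i a b)

  path-unique : (p : Walk G (ES i) (term a) (term b)) → IsPath G p →
                verts G p ≡ verts G (path i a b) × edges G p ≡ edges G (path i a b)
  path-unique {i} {a} {b} p up = tree-path-unique (tree i) p (path i a b) up (path-isPath i a b)

  Inner : Fin k → Fin r → Fin r → Fin n → Set
  Inner i a b x = x ∈ verts G (path i a b) × x ≢ term a × x ≢ term b

  Inner? : ∀ i a b x → Dec (Inner i a b x)
  Inner? i a b x = (x ∈? verts G (path i a b)) ×-dec ¬? (x ≟ term a) ×-dec ¬? (x ≟ term b)

  nonterminal⇒Inner : ∀ {i a b y} (p : Walk G (ES i) (term a) (term b)) → IsPath G p →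
                      y ∈ verts G p → ¬ R y → Inner i a b y
  nonterminal⇒Inner p up m ¬R =
    subst (_ ∈_) (proj₁ (path-unique p up)) m , (λ eq → ¬R (_ , sym eq)) , (λ eq → ¬R (_ , sym eq))

  private
    reversed : ∀ i a b → verts G (reverseʷ (path i a b)) ≡ verts G (path i b a) ×
                         edges G (reverseʷ (path i a b)) ≡ edges G (path i b a)
    reversed i a b = path-unique (reverseʷ (path i a b)) (IsPath-reverseʷ _ (path-isPath i a b))

    concatenated : ∀ i a b c → PathAlong (path i a c ++ʷ path i c b)
    concatenated i a b c = pathAlong _

    concatenated-unique : ∀ i a b c → verts G (PathAlong.path (concatenated i a b c)) ≡ verts G (path i a b) ×
                                      edges G (PathAlong.path (concatenated i a b c)) ≡ edges G (path i a b)
    concatenated-unique i a b c = path-unique _ (PathAlong.isPath (concatenated i a b c))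

  Inner-sym : Inner i a b x → Inner i b a x
  Inner-sym {i} {a} {b} (m , x≢a , x≢b) =
    subst (_ ∈_) (proj₁ (reversed i a b)) (∈-verts-reverseʷ⁺ _ m) , x≢b , x≢a

  ∈-edges-path-sym : e ∈ edges G (path i a b) → e ∈ edges G (path i b a)
  ∈-edges-path-sym {i = i} {a} {b} m = subst (_ ∈_) (proj₂ (reversed i a b)) (∈-edges-reverseʷ⁺ _ m)

  Inner-split : Inner i a b x → x ≢ term c → Inner i a c x ⊎ Inner i c b x
  Inner-split {i} {a} {b} {x} {c} (m , x≢a , x≢b) x≢c
    with ∈-verts-++ʷ⁻ (path i a c) (path i c b)
           (PathAlong.verts⊆ (concatenated i a b c) (subst (x ∈_) (sym (proj₁ (concatenated-unique i a b c))) m))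
  ... | inj₁ m′ = inj₁ (m′ , x≢a , x≢c)
  ... | inj₂ m′ = inj₂ (m′ , x≢c , x≢b)

  ∈-edges-path-split : ∀ c → e ∈ edges G (path i a b) → e ∈ edges G (path i a c) ⊎ e ∈ edges G (path i c b)
  ∈-edges-path-split {e} {i} {a} {b} c m =
    ∈-edges-++ʷ⁻ (path i a c) (path i c b)
      (PathAlong.edges⊆ (concatenated i a b c) (subst (e ∈_) (sym (proj₂ (concatenated-unique i a b c))) m))

  innerSplitting : ∀ i x → Splitting (λ c → x ≢ term c) (λ a b → Inner i a b x)
  innerSplitting i x = record
    { ends-ok   = λ (_ , x≢a , x≢b) → x≢a , x≢b
    ; symmetric = Inner-sym
    ; split     = λ c x≢c I → Inner-split I x≢c
    }

  edgeSplitting : ∀ i e → Splitting (λ _ → ⊤) (λ a b → e ∈ edges G (path i a b))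
  edgeSplitting i e = record
    { ends-ok   = λ _ → tt , tt
    ; symmetric = ∈-edges-path-sym
    ; split     = λ c _ → ∈-edges-path-split c
    }

  Inner-disjoint : i ≢ j → Inner i a b x → Inner j a′ b′ x → ⊥
  Inner-disjoint {i} {j} {x = x} i≢j = splittings-disjoint (innerSplitting i x) (innerSplitting j x) clash
    where
      clash : Inner i a b x → Inner j a b x → ⊥
      clash {a} {b} (m , x≢a , x≢b) (m′ , _ , _) =
        proj₂ (independent _ _ (a , refl) (b , refl) (IsPath⇒ends-distinct _ (path-isPath i a b) m x≢a)
                 i j i≢j (path i a b) (path-isPath i a b) (path j a b) (path-isPath j a b))
          x m m′ x≢a x≢b

  edges-disjoint : i ≢ j → e ∈ edges G (path i a b) → e ∈ edges G (path j a′ b′) → ⊥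
  edges-disjoint {i} {j} {e} i≢j = splittings-disjoint (edgeSplitting i e) (edgeSplitting j e) clash
    where
      clash : e ∈ edges G (path i a b) → e ∈ edges G (path j a b) → ⊥
      clash {a} {b} m m′ =
        proj₁ (independent _ _ (a , refl) (b , refl) (IsPath⇒ends-distinct-edge loopless _ (path-isPath i a b) m)
                 i j i≢j (path i a b) (path-isPath i a b) (path j a b) (path-isPath j a b))
          e m m′

  record TerminalThrough (i : Fin k) (v : Fin n) (e : Fin m) : Set where
    field
      {terminal}  : Fin r
      {neighbour} : Fin n
      walk        : Walk G (ES i) (term terminal) neighbour
      isPath      : IsPath G walk
      avoids      : v ∉ verts G walk
      joins       : Joins G e neighbour v

  private
    -- W is extended at its start until it starts at a terminal: a non-terminal start is interior
    -- to the Steiner tree, so a second tree edge leaves it, and IsTree-prepend keeps the result a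
    -- path.  A path has at most n vertices, which bounds the number of steps.
    grow : ∀ i {v y e} (s : ES i e) (j : Joins G e y v) (fuel : ℕ)
           {z w g} (W : Walk G (ES i) z y) (sg : ES i g) (jg : Joins G g z w) (rest : Walk G (ES i) w v) →
           W ++ʷ step e s j ≡ cons g sg jg rest → IsPath G (cons g sg jg rest) →
           n < fuel + length (verts G W) → ¬ ¬ TerminalThrough i v e
    grow i s j zero W sg jg rest eq up bound _ =
      <-irrefl refl (<-≤-trans bound (Unique⇒length≤ _ (proj₁ (IsPath-++ʷ-step⁻ W s j (subst (IsPath G) (sym eq) up)))))
    grow i {v} s j (suc fuel) {z} {g = g} W sg jg rest eq up bound ¬through with R? z
    ... | yes (a , refl) =
      let pW , v∉W = IsPath-++ʷ-step⁻ W s j (subst (IsPath G) (sym eq) up) in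
      ¬through (record { walk = W ; isPath = pW ; avoids = v∉W ; joins = j })
    ... | no ¬Rz = ¬Rz (proj₂ (steiner i) z (Incident⇒VS (tree i) sg (Joins⇒Incidentˡ jg)) ¬interior)
      where
        extend : ∀ {f} → ES i f → Incident G f z → f ≢ g → ⊥
        extend sf i-f f≢g with Incident⇒Joins i-f
        ... | _ , jf = grow i s j fuel (cons _ sf jf W) sf jf (cons _ sg jg rest) (cong (cons _ sf jf) eq)
                         (IsTree-prepend (tree i) sg jg rest up sf jf f≢g)
                         (subst (n <_) (sym (+-suc fuel _)) bound) ¬through

        ¬interior : ¬ IsInterior G (ES i) z
        ¬interior (f₁ , f₂ , f₁≢f₂ , s₁ , s₂ , i₁ , i₂) with f₁ ≟ g
        ... | yes refl = extend s₂ i₂ (f₁≢f₂ ∘ sym)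
        ... | no f₁≢g = extend s₁ i₁ f₁≢g

  -- Only doubly negated, since IsInterior is not decidable (the edge set of a subtree is an
  -- arbitrary predicate); IsNonPendant⇒Inner removes the negations using decidability of Inner.
  terminalThrough : ∀ i {v e} → ES i e → Incident G e v → ¬ ¬ TerminalThrough i v e
  terminalThrough i s i-e with Incident⇒Joins i-e
  ... | _ , j = grow i s j n nil s j nil refl (IsPath-step {ES = ES i} loopless s j) (m<m+n n (s≤s z≤n))

  InnerSomewhere : Fin k → Fin n → Set
  InnerSomewhere i x = Σ (Fin r) λ a → Σ (Fin r) λ b → Inner i a b x

  private
    open TerminalThrough using (terminal; walk; avoids; joins)

    terminal≢ : ∀ {i v f} (B : TerminalThrough i v f) → v ≢ term (terminal B)
    terminal≢ B eq = avoids B (subst (_∈ _) (sym eq) (start∈verts (walk B)))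

    between : ∀ {i v f₁ f₂} → ES i f₁ → ES i f₂ → f₁ ≢ f₂ →
              TerminalThrough i v f₁ → TerminalThrough i v f₂ → InnerSomewhere i v
    between {i} {v} s₁ s₂ f₁≢f₂ B₁ B₂ with v ∈? verts G (path i (terminal B₁) (terminal B₂))
    ... | yes m = _ , _ , m , terminal≢ B₁ , terminal≢ B₂
    ... | no v∉ = ⊥-elim (IsTree-no-detour (tree i) s₁ s₂ f₁≢f₂ (Joins-sym (joins B₁)) (joins B₂)
                            (PathAlong.path L) (PathAlong.isPath L) v∉L)
      where
        L = pathAlong (reverseʷ (walk B₁) ++ʷ path i _ _ ++ʷ walk B₂)
        v∉L : v ∉ verts G (PathAlong.path L)
        v∉L m with ∈-verts-++ʷ⁻ (reverseʷ (walk B₁)) _ (PathAlong.verts⊆ L m)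
        ... | inj₁ m₁ = avoids B₁ (∈-verts-reverseʷ⁻ (walk B₁) m₁)
        ... | inj₂ m′ with ∈-verts-++ʷ⁻ (path i _ _) (walk B₂) m′
        ...   | inj₁ m₀ = v∉ m₀
        ...   | inj₂ m₂ = avoids B₂ m₂

  IsNonPendant⇒Inner : ∀ i → IsNonPendant G R (T i) → Σ (Fin r) λ c → InnerSomewhere i (term c)
  IsNonPendant⇒Inner i (_ , _ , (c , refl) , f₁ , f₂ , f₁≢f₂ , s₁ , s₂ , i₁ , i₂) =
    decidable-stable (any? λ c → any? λ a → any? λ b → Inner? i a b (term c)) λ ¬inner →
      terminalThrough i s₁ i₁ λ B₁ → terminalThrough i s₂ i₂ λ B₂ →
        ¬inner (c , between s₁ s₂ f₁≢f₂ B₁ B₂)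

  record RootChoice : Set where
    field
      root           : Fin k → Fin r
      root-injective : ∀ {i j} → i ≢ j → root i ≢ root j
      root-not-inner : ∀ {i j} → i ≢ j → ¬ InnerSomewhere j (term (root i))

  pendantRoots : k ≤ r → (∀ i → IsPendant G R (T i)) → RootChoice
  pendantRoots k≤r pendant = record
    { root           = λ i → inject≤ i k≤r
    ; root-injective = λ i≢j eq → i≢j (inject≤-injective k≤r k≤r _ _ eq)
    ; root-not-inner = λ {_} {j} _ (_ , _ , m , x≢a , x≢b) →
        proj₂ (pendant j) _ (_ , refl) (IsPath⇒IsInterior _ (path-isPath j _ _) m x≢a x≢b)
    }

  nonPendantRoots : (∀ i → IsNonPendant G R (T i)) → RootChoice
  nonPendantRoots nonPendant = record
    { root           = λ i → proj₁ (inner i)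
    ; root-injective = λ {i} {j} i≢j eq →
        disjoint i≢j (proj₂ (inner i)) (subst (InnerSomewhere j ∘ term) (sym eq) (proj₂ (inner j)))
    ; root-not-inner = λ {i} i≢j → disjoint i≢j (proj₂ (inner i))
    }
    where
      inner : ∀ i → Σ (Fin r) λ c → InnerSomewhere i (term c)
      inner i = IsNonPendant⇒Inner i (nonPendant i)
      disjoint : i ≢ j → InnerSomewhere i x → InnerSomewhere j x → ⊥
      disjoint i≢j (_ , _ , I) (_ , _ , J) = Inner-disjoint i≢j I J

  private
    indexIfTerminal : Dec (R x) → Fin r → Fin r
    indexIfTerminal (yes (j , _)) _ = j
    indexIfTerminal (no _) c = c

    afterVertex : Fin r → Fin n → Fin r
    afterVertex c y = indexIfTerminal (R? y) c

    afterVertex-term : ∀ c j → afterVertex c (term j) ≡ j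
    afterVertex-term c j with R? (term j)
    ... | yes (j′ , eq) = term-injective eq
    ... | no ¬R = ⊥-elim (¬R (j , refl))

  -- The last terminal in the list, or the default c if it contains none.
  lastTerminal : Fin r → List (Fin n) → Fin r
  lastTerminal = foldl afterVertex

  lastTerminal-∷ʳ-term : ∀ c xs j → lastTerminal c (xs ∷ʳ term j) ≡ j
  lastTerminal-∷ʳ-term c xs j = trans (foldl-∷ʳ afterVertex c (term j) xs) (afterVertex-term _ j)

  lastTerminal-∷ʳ-nonterm : ∀ c xs {w} → ¬ R w → lastTerminal c (xs ∷ʳ w) ≡ lastTerminal c xs
  lastTerminal-∷ʳ-nonterm c xs {w} ¬R = trans (foldl-∷ʳ afterVertex c w xs) (skip (R? w))
    where
      skip : (d : Dec (R w)) → indexIfTerminal d (lastTerminal c xs) ≡ lastTerminal c xs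
      skip (yes R) = ⊥-elim (¬R R)
      skip (no _) = refl

  lastTerminal-∈ : ∀ c xs → lastTerminal c xs ≡ c ⊎ term (lastTerminal c xs) ∈ xs
  lastTerminal-∈ c [] = inj₁ refl
  lastTerminal-∈ c (y ∷ ys) with R? y
  ... | yes (j , tj≡y) = inj₂ ([ (λ eq → here (trans (cong term eq) tj≡y)) , there ]′ (lastTerminal-∈ j ys))
  ... | no _ = Sum.map₂ there (lastTerminal-∈ c ys)

  module Rooted (roots : RootChoice) (connected : Connected G) (z₀ : Fin r) where
    open RootChoice roots

    rootPath : ∀ i t → Walk G (ES i) (term (root i)) (term t)
    rootPath i = path i (root i)

    OnRootPath : Fin n → Set
    OnRootPath x = Σ (Fin k) λ i → Σ (Fin r) λ t → Inner i (root i) t x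

    private
      OnRootPath? : ∀ x → Dec (OnRootPath x)
      OnRootPath? x = any? λ i → any? λ t → Inner? i (root i) t x

      parentOf : OnRootPath x → Fin r
      parentOf (i , t , m , _) = lastTerminal (root i) (verts G (proj₁ (splitAt (rootPath i t) m)))

    -- A vertex strictly inside a root path is seeded with the last terminal before it on that path;
    -- by Inner-disjoint and uniqueness of tree paths this does not depend on the root path.
    seed : Fin n → Maybe (Fin r)
    seed x with R? x
    ... | yes (j , _) = just j
    ... | no _ with OnRootPath? x
    ...   | yes o = just (parentOf o)
    ...   | no _ = nothing

    seed-term : ∀ j → seed (term j) ≡ just j
    seed-term j with R? (term j)
    ... | yes (j′ , eq) = cong just (term-injective eq)
    ... | no ¬R = ⊥-elim (¬R (j , refl))

    seed-inner : ∀ {i t x} → ¬ R x → Inner i (root i) t x → (A : Walk G (ES i) (term (root i)) x) →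
                 IsPath G A → seed x ≡ just (lastTerminal (root i) (verts G A))
    seed-inner {i} {t} {x} ¬R I A pA with R? x
    ... | yes R = ⊥-elim (¬R R)
    ... | no _ with OnRootPath? x
    ...   | no ¬o = ⊥-elim (¬o (i , t , I))
    ...   | yes (i′ , t′ , I′) with i′ ≟ i
    ...     | no i′≢i = ⊥-elim (Inner-disjoint i′≢i I′ I)
    ...     | yes refl with splitAt (rootPath i t′) (proj₁ I′)
    ...       | A′ , B′ , eq = cong (just ∘ lastTerminal (root i)) (proj₁ (tree-path-unique (tree i) A′ A pA′ pA))
      where pA′ = proj₁ (IsPath-++ʷ⁻ A′ B′ (subst (IsPath G) eq (path-isPath i (root i) t′)))

    open LabelExtension e₁ e₂ connected seed (term z₀) (seed-term z₀)

    label-term : ∀ j → label (term j) ≡ j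
    label-term j = label-seed (seed-term j)

    label-on-rootPath : ∀ {i t y} (A : Walk G (ES i) (term (root i)) y) (B : Walk G (ES i) y (term t)) →
                        IsPath G (A ++ʷ B) → label y ≡ lastTerminal (root i) (verts G A)
    label-on-rootPath {i} {y = y} A B up with R? y
    ... | yes (j , refl) = begin
      label (term j)                                        ≡⟨ label-term j ⟩
      j                                                     ≡⟨ lastTerminal-∷ʳ-term (root i) (initVerts A) j ⟨
      lastTerminal (root i) (initVerts A ∷ʳ term j)         ≡⟨ cong (lastTerminal (root i)) (verts≡initVerts∷ʳ A) ⟨
      lastTerminal (root i) (verts G A)                     ∎
      where open ≡-Reasoning
    ... | no ¬R = label-seed (seed-inner ¬R
      (nonterminal⇒Inner (A ++ʷ B) up (∈-verts-++ʷ⁺ʳ A B (start∈verts B)) ¬R) A (proj₁ (IsPath-++ʷ⁻ A B up)))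

    ToTerminal : Fin r → Fin n → Set
    ToTerminal c x = Walk G (InClass c) x (term c)

    private
      toTerminal-term : ∀ j → ToTerminal (label (term j)) (term j)
      toTerminal-term j = subst (λ c → ToTerminal c (term j)) (sym (label-term j)) nil

      along : ∀ {i t y} (A : Walk G (ES i) (term (root i)) y) (B : Walk G (ES i) y (term t)) →
              IsPath G (A ++ʷ B) → ToTerminal (label y) y → ∀ {x} → x ∈ verts G B → ToTerminal (label x) x
      along A nil _ walk (here refl) = walk
      along A (cons e s j B) _ walk (here refl) = walk
      along {i} {y = y} A (cons {w = w} e s j B) up walk (there m) = along (A ++ʷ step e s j) B up′ (walk′ (R? w)) m
        where
          up′ : IsPath G ((A ++ʷ step e s j) ++ʷ B)
          up′ = subst (IsPath G) (sym (++ʷ-assoc A (step e s j) B)) up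

          walk′ : Dec (R w) → ToTerminal (label w) w
          walk′ (yes (j′ , refl)) = toTerminal-term j′
          walk′ (no ¬R) = cons e (Joins⇒InClass (Joins-sym j) refl (sym w~y)) (Joins-sym j)
                                 (subst (λ c → ToTerminal c y) (sym w~y) walk)
            where
              open ≡-Reasoning
              w~y : label w ≡ label y
              w~y = begin
                label w                                             ≡⟨ label-on-rootPath (A ++ʷ step e s j) B up′ ⟩
                lastTerminal (root i) (verts G (A ++ʷ step e s j))  ≡⟨ cong (lastTerminal (root i)) (verts-++ʷ-step A s j) ⟩
                lastTerminal (root i) (verts G A ∷ʳ w)              ≡⟨ lastTerminal-∷ʳ-nonterm (root i) (verts G A) ¬R ⟩
                lastTerminal (root i) (verts G A)                   ≡⟨ label-on-rootPath A (cons e s j B) up ⟨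
                label y                                             ∎

      walkFromSeed : ∀ x {c} → seed x ≡ just c → ToTerminal (label x) x
      walkFromSeed x with R? x
      ... | yes (j , refl) = λ _ → toTerminal-term j
      ... | no _ with OnRootPath? x
      ...   | yes (i , t , m , _) = λ _ → along nil (rootPath i t) (path-isPath i (root i) t) (toTerminal-term (root i)) m
      ...   | no _ = λ ()

    toTerminal : ∀ x → ToTerminal (label x) x
    toTerminal x with walkToSeed x
    ... | y , seed-y , p = p ++ʷ subst (λ c → ToTerminal c y) (label-seed seed-y) (walkFromSeed y seed-y)

    isRPartition : IsRPartition G term label
    isRPartition = label-term , λ c u v ℓu ℓv →
      subst (λ c → ToTerminal c u) ℓu (toTerminal u) ++ʷ reverseʷ (subst (λ c → ToTerminal c v) ℓv (toTerminal v))

    private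
      M : Multigraph
      M = DirectedRMinor G term label

      Arc : Set
      Arc = MinorArc G term label

      orientation : ∀ {e y z} → Joins G e y z → Bool
      orientation (inj₁ _) = true
      orientation (inj₂ _) = false

      tailV-orientation : ∀ {e y z} (j : Joins G e y z) → tailV G term label (e , orientation j) ≡ y
      tailV-orientation (inj₁ (p , _)) = p
      tailV-orientation (inj₂ (p , _)) = p

      headV-orientation : ∀ {e y z} (j : Joins G e y z) → headV G term label (e , orientation j) ≡ z
      headV-orientation (inj₁ (_ , q)) = q
      headV-orientation (inj₂ (_ , q)) = q

      root≢⇒term≢ : ∀ {i t} → t ≢ root i → term (root i) ≢ term t
      root≢⇒term≢ t≢root eq = t≢root (sym (term-injective eq))

    depth : Fin k → Fin r → ℕ
    depth i t = length (edges G (rootPath i t))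

    Junction : Fin k → Fin r → Set
    Junction i v = root i ≡ v ⊎ InnerSomewhere i (term v)

    junction-disjoint : ∀ {i j v} → i ≢ j → Junction i v → Junction j v → ⊥
    junction-disjoint i≢j (inj₁ p) (inj₁ q) = root-injective i≢j (trans p (sym q))
    junction-disjoint {j = j} i≢j (inj₁ p) (inj₂ J) = root-not-inner i≢j (subst (InnerSomewhere j ∘ term) (sym p) J)
    junction-disjoint {i} i≢j (inj₂ I) (inj₁ q) = root-not-inner (i≢j ∘ sym) (subst (InnerSomewhere i ∘ term) (sym q) I)
    junction-disjoint i≢j (inj₂ (_ , _ , I)) (inj₂ (_ , _ , J)) = Inner-disjoint i≢j I J

    module _ {i t} (L : Snoc (rootPath i t)) where
      open Snoc L

      parent : Fin r
      parent = lastTerminal (root i) (verts G init)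

      private
        last-isPath : IsPath G (init ++ʷ step lastEdge lastEdge∈ lastJoins)
        last-isPath = subst (IsPath G) split (path-isPath i (root i) t)

        label-penultimate : label penultimate ≡ parent
        label-penultimate = label-on-rootPath init (step lastEdge lastEdge∈ lastJoins) last-isPath

      parent∈init : term parent ∈ verts G init
      parent∈init with lastTerminal-∈ (root i) (verts G init)
      ... | inj₁ eq = subst (λ c → term c ∈ verts G init) (sym eq) (start∈verts init)
      ... | inj₂ m = m

      parent≢ : parent ≢ t
      parent≢ eq = proj₂ (IsPath-++ʷ-step⁻ init lastEdge∈ lastJoins last-isPath)
                     (subst (λ c → term c ∈ verts G init) eq parent∈init)

      private
        oriented : Fin m × Bool
        oriented = lastEdge , orientation lastJoins

      lastArc-head : label (headV G term label oriented) ≡ t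
      lastArc-head = trans (cong label (headV-orientation lastJoins)) (label-term t)

      lastArc-tail : label (tailV G term label oriented) ≡ parent
      lastArc-tail = trans (cong label (tailV-orientation lastJoins)) label-penultimate

      lastArc : Arc
      lastArc = oriented ,
        (λ eq → parent≢ (trans (sym lastArc-tail) (trans eq lastArc-head))) ,
        trans (headV-orientation lastJoins) (cong term (sym lastArc-head))

      lastArc-edge : lastEdge ∈ edges G (rootPath i t)
      lastArc-edge = subst (λ p → lastEdge ∈ edges G p) (sym split) (∈-edges-++ʷ⁺ʳ init _ (here refl))

      parent-junction : Junction i parent
      parent-junction with parent ≟ root i
      ... | yes p≡root = inj₁ (sym p≡root)
      ... | no p≢root = inj₂ (root i , t , parent∈rootPath , p≢root ∘ term-injective , parent≢ ∘ term-injective)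
        where
          parent∈rootPath : term parent ∈ verts G (rootPath i t)
          parent∈rootPath = subst (λ p → term parent ∈ verts G p) (sym split) (∈-verts-++ʷ⁺ˡ init _ parent∈init)

      parent-depth : depth i parent < depth i t
      parent-depth = let A₁ , A₂ , eq = splitAt init parent∈init in via A₁ A₂ eq
        where
          via : (A₁ : Walk G (ES i) (term (root i)) (term parent)) (A₂ : Walk G (ES i) (term parent) penultimate) →
                init ≡ A₁ ++ʷ A₂ → depth i parent < depth i t
          via A₁ A₂ eq = begin-strict
            depth i parent                             ≡⟨ cong length (proj₂ (path-unique A₁ pA₁)) ⟨
            length (edges G A₁)                        <⟨ m<m+n _ (++ʷ-step-nonempty A₂ lastEdge∈ lastJoins) ⟩
            length (edges G A₁) + length (edges G W₂)  ≡⟨ length-++ (edges G A₁) ⟨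
            length (edges G A₁ ++ edges G W₂)          ≡⟨ cong length (edges-++ʷ A₁ W₂) ⟨
            length (edges G (A₁ ++ʷ W₂))               ≡⟨ cong (length ∘ edges G) decomposition ⟨
            depth i t                                  ∎
            where
              open ≤-Reasoning
              W₂ = A₂ ++ʷ step lastEdge lastEdge∈ lastJoins
              decomposition : rootPath i t ≡ A₁ ++ʷ W₂
              decomposition = trans split (trans (cong (_++ʷ step lastEdge lastEdge∈ lastJoins) eq) (++ʷ-assoc A₁ A₂ _))
              pA₁ = proj₁ (IsPath-++ʷ⁻ A₁ W₂ (subst (IsPath G) decomposition (path-isPath i (root i) t)))

    private
      arcTo : Fin k → Fin r → Maybe Arc
      arcTo i t with t ≟ root i
      ... | yes _ = nothing
      ... | no t≢root = just (lastArc (snocView (rootPath i t) (root≢⇒term≢ t≢root)))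

      arcTo-just : ∀ {i t a} → arcTo i t ≡ just a → t ≢ root i × Σ (Snoc (rootPath i t)) λ L → lastArc L ≡ a
      arcTo-just {i} {t} with t ≟ root i
      ... | yes _ = λ ()
      ... | no t≢root = λ eq → t≢root , snocView (rootPath i t) (root≢⇒term≢ t≢root) , just-injective eq

      arcTo-exists : ∀ {i t} → t ≢ root i → Σ Arc λ a → arcTo i t ≡ just a
      arcTo-exists {i} {t} t≢root with t ≟ root i
      ... | yes t≡root = ⊥-elim (t≢root t≡root)
      ... | no _ = _ , refl

    ArcOf : Fin k → Arc → Set
    ArcOf i a = Σ (Fin r) λ t → arcTo i t ≡ just a

    private
      open Multigraph M using (end₁; end₂)

      ArcOf-head : ∀ {i a} (h : ArcOf i a) → end₂ a ≡ proj₁ h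
      ArcOf-head (t , eq) with arcTo-just eq
      ... | _ , L , refl = lastArc-head L

      ArcOf-tail : ∀ {i a} → ArcOf i a → Junction i (end₁ a)
      ArcOf-tail {i} (t , eq) with arcTo-just eq
      ... | _ , L , refl = subst (Junction i) (sym (lastArc-tail L)) (parent-junction L)

      ArcOf-depth : ∀ {i a} → ArcOf i a → depth i (end₁ a) < depth i (end₂ a)
      ArcOf-depth {i} (t , eq) with arcTo-just eq
      ... | _ , L , refl = subst₂ (λ x y → depth i x < depth i y) (sym (lastArc-tail L)) (sym (lastArc-head L)) (parent-depth L)

      ArcOf-edge : ∀ {i a} (h : ArcOf i a) → proj₁ (proj₁ a) ∈ edges G (rootPath i (proj₁ h))
      ArcOf-edge (t , eq) with arcTo-just eq
      ... | _ , L , refl = lastArc-edge L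

      ArcOf-in-unique : ∀ {i a a′} → ArcOf i a → ArcOf i a′ → end₂ a ≡ end₂ a′ → a ≡ a′
      ArcOf-in-unique h@(t , eq) h′@(t′ , eq′) heads with trans (sym (ArcOf-head h)) (trans heads (ArcOf-head h′))
      ... | refl = just-injective (trans (sym eq) eq′)

      ArcOf-root : ∀ {i a} → ArcOf i a → end₂ a ≢ root i
      ArcOf-root h@(t , eq) head≡root = proj₁ (arcTo-just eq) (trans (sym (ArcOf-head h)) head≡root)

      ArcOf-in-arc : ∀ {i} v → v ≢ root i → Σ Arc λ a → ArcOf i a × end₂ a ≡ v
      ArcOf-in-arc v v≢root = let a , eq = arcTo-exists v≢root in a , (v , eq) , ArcOf-head (v , eq)

      module Arborescence (i : Fin k) =
        ParentArcs M _≟_ (ArcOf i) (root i) (depth i) ArcOf-depth ArcOf-in-unique ArcOf-root ArcOf-in-arc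

      interior-junction : ∀ {i v} → IsInterior M (ArcOf i) v → Junction i v
      interior-junction {i} I = let _ , h , tail≡v = Arborescence.interior⇒tail i I in
        subst (Junction i) tail≡v (ArcOf-tail h)

    cisa : CISA M k
    cisa = ArcOf , Arborescence.isSpanningArborescence , λ i j i≢j →
      (λ v I J → junction-disjoint i≢j (interior-junction I) (interior-junction J)) ,
      (λ a h h′ → edges-disjoint i≢j (ArcOf-edge h) (ArcOf-edge h′))

    minorWithCISA : Σ (Fin n → Fin r) λ f → IsRPartition G term f × CISA (DirectedRMinor G term f) k
    minorWithCISA = label , isRPartition , cisa

theorem3p26 : (n m : ℕ) (e₁ e₂ : Fin m → Fin n) →
    Loopless (mkGraph n m e₁ e₂) → Connected (mkGraph n m e₁ e₂) →
    (r : ℕ) (term : Fin r → Fin n) → Injective _≡_ _≡_ term → 2 ≤ r →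
    (k : ℕ) → k ≤ r →
    (PendantCIST (mkGraph n m e₁ e₂) (InR (mkGraph n m e₁ e₂) term) k
      ⊎ NonPendantCIST (mkGraph n m e₁ e₂) (InR (mkGraph n m e₁ e₂) term) k) →
    Σ (Fin n → Fin r) λ f → IsRPartition (mkGraph n m e₁ e₂) term f
      × CISA (DirectedRMinor (mkGraph n m e₁ e₂) term f) k
theorem3p26 n m e₁ e₂ loopless connected r term term-injective (s≤s _) k k≤r (inj₁ (T , pendant , independent)) =
  Rooted.minorWithCISA (pendantRoots k≤r pendant) connected zero
  where open CIST loopless term-injective T (proj₁ ∘ pendant) independent
theorem3p26 n m e₁ e₂ loopless connected r term term-injective (s≤s _) k k≤r (inj₂ (T , nonPendant , independent)) =
  Rooted.minorWithCISA (nonPendantRoots nonPendant) connected zero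
  where open CIST loopless term-injective T (proj₁ ∘ nonPendant) independent
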